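{- For any digraph $D$ of order $n$, $\gamma_{oso}(D)\le n-\delta^0(D)$.
   Context: Digraphs $D=(V,A)$ are finite, without loops or multiple arcs (pairs of opposite arcs allowed); $n=|V|$. $N^+(v)=\{w: vw\in A\}$, $N^-(v)=\{w: wv\in A\}$, $d^\pm(v)=|N^\pm(v)|$, $\delta^0(D)=\min_{v}\min\{d^+(v),d^-(v)\}$. A set $S\subseteq V$ is out-dominating if every $v\in V\setminus S$ has an in-neighbor in $S$. $S$ is an out-secure out-dominating set (OSODS) if $S$ is out-dominating and for every $v\in V\setminus S$ there is $u\in N^-(v)\cap S$ such that $(S\setminus\{u\})\cup\{v\}$ is out-dominating. $\gamma_{oso}(D)$ is the minimum size of an OSODS of $D$. -}

module Defs where

open import Data.Nat using (ℕ; zero; suc; _⊓_)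
open import Data.Fin using (Fin)
open import Data.Fin.Subset using (Subset; _∈_; _∉_; ∣_∣; ⁅_⁆; _∪_; _-_)
open import Data.Vec using (tabulate; allFin)
open import Data.Vec using (foldr′) renaming (map to vmap)
open import Data.Bool using (Bool)
open import Data.Product using (Σ; _×_; ∃-syntax; _,_)
open import Relation.Nullary using (¬_; Dec; does)
open import Relation.Binary.PropositionalEquality using (_≡_)
open import Level using (0ℓ)

-- A digraph on vertex set Fin n: a decidable, irreflexive arc relation.
-- Loops are excluded; opposite arcs are allowed; no multiple arcs (relation).
record Digraph (n : ℕ) : Set₁ where
  field
    Arc     : Fin n → Fin n → Set
    arc?    : (u v : Fin n) → Dec (Arc u v)
    loopless : (v : Fin n) → ¬ Arc v v

open Digraph public

N⁺ : ∀ {n} → Digraph n → Fin n → Subset n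
N⁺ D v = tabulate (λ w → does (arc? D v w))

N⁻ : ∀ {n} → Digraph n → Fin n → Subset n
N⁻ D v = tabulate (λ w → does (arc? D w v))

d⁺ d⁻ : ∀ {n} → Digraph n → Fin n → ℕ
d⁺ D v = ∣ N⁺ D v ∣
d⁻ D v = ∣ N⁻ D v ∣

-- δ⁰(D) = min_v min{d⁺(v), d⁻(v)}.  For n = 0 (empty digraph) we use 0.
δ⁰ : ∀ {n} → Digraph n → ℕ
δ⁰ {zero}  D = 0
δ⁰ {suc n} D =
  foldr′ _⊓_ (d⁺ D Fin.zero ⊓ d⁻ D Fin.zero)
         (vmap (λ v → d⁺ D v ⊓ d⁻ D v) (allFin (suc n)))
  where import Data.Fin as Fin

OutDominating : ∀ {n} → Digraph n → Subset n → Set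
OutDominating D S = ∀ v → v ∉ S → ∃[ u ] (u ∈ S × Arc D u v)

OSODS : ∀ {n} → Digraph n → Subset n → Set
OSODS D S =
  OutDominating D S ×
  (∀ v → v ∉ S →
     ∃[ u ] (u ∈ S × Arc D u v × OutDominating D ((S - u) ∪ ⁅ v ⁆)))

-- If the complement of S has at most as many vertices as the in-degree of
-- every vertex, then S is out-dominating: the in-neighbourhood of v ∉ S
-- cannot fit into ∁ S, which contains v but not its in-neighbours.  Swapping
-- v ∉ S for one of its in-neighbours u ∈ S does not shrink S, so every such
-- swap is again out-dominating.  Hence any S of size n ∸ δ⁰ is an OSODS.
module Submission where

open import Defs
open import Data.Nat using (ℕ; _≤_; _∸_; zero; suc; _<_; _⊓_; s≤s)
open import Data.Fin.Subset
  using (Subset; ∣_∣; _∈_; _∉_; ⁅_⁆; _∪_; _-_; ∁; ⊥; _⊆_; _⊂_; inside; outside)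
open import Data.Product using (∃-syntax; _×_; Σ; _,_)
import Data.Fin as Fin
open import Data.Nat.Properties
  using (≤-refl; ≤-trans; ≤-reflexive; <-≤-trans; <-irrefl; n≤1+n; m⊓n≤m; m⊓n≤n;
         m∸n≤m; ∸-monoʳ-≤; m≤n+m∸n; m≤n+o⇒m∸n≤o; +-comm; module ≤-Reasoning)
open import Data.Fin using (Fin; _≟_)
open import Data.Fin.Subset.Properties
  using (_∈?_; x∉p⇒x∈∁p; x∉∁p⇒x∈p; p⊆q⇒∣p∣≤∣q∣; p⊂q⇒∣p∣<∣q∣; ∣∁p∣≡n∸∣p∣; ∣⊥∣≡0;
         x∈⁅x⁆; p⊆p∪q; q⊆p∪q; p─q⊆p; x∈p∧x≢y⇒x∈p-y; ∪-identityʳ)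
open import Data.Fin.Properties using (any?)
open import Data.Vec using (Vec; _∷_; lookup; allFin; foldr′) renaming (map to vmap)
open import Data.Vec.Properties using (lookup∘tabulate; lookup-map; lookup-allFin; []=⇒lookup)
open import Data.Empty using (⊥-elim)
open import Relation.Nullary using (yes; no; does)
open import Relation.Nullary.Decidable using (¬?; _×-dec_)
open import Relation.Binary.PropositionalEquality using (_≡_; refl; sym; trans; cong)

module _ {n : ℕ} (D : Digraph n) where

  ∈N⁻⇒Arc : ∀ {w v} → w ∈ N⁻ D v → Arc D w v
  ∈N⁻⇒Arc {w} {v} w∈N⁻v
    with arc? D w v | trans (sym (lookup∘tabulate (λ x → does (arc? D x v)) w)) ([]=⇒lookup w∈N⁻v)
  ... | yes arc | _ = arc
  ... | no _    | ()

  v∉N⁻v : ∀ v → v ∉ N⁻ D v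
  v∉N⁻v v v∈N⁻v = loopless D v (∈N⁻⇒Arc v∈N⁻v)

  in-neighbour-outside : ∀ {v T} → v ∈ T → ∣ T ∣ ≤ d⁻ D v → ∃[ u ] (u ∉ T × Arc D u v)
  in-neighbour-outside {v} {T} v∈T ∣T∣≤d⁻v
    with any? (λ u → ¬? (u ∈? T) ×-dec arc? D u v)
  ... | yes witness = witness
  ... | no ∄u = ⊥-elim (<-irrefl refl (<-≤-trans d⁻v<∣T∣ ∣T∣≤d⁻v))
    where
    N⁻v⊆T : N⁻ D v ⊆ T
    N⁻v⊆T {w} w∈N⁻v with w ∈? T
    ... | yes w∈T = w∈T
    ... | no  w∉T = ⊥-elim (∄u (w , w∉T , ∈N⁻⇒Arc w∈N⁻v))

    d⁻v<∣T∣ : d⁻ D v < ∣ T ∣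
    d⁻v<∣T∣ = p⊂q⇒∣p∣<∣q∣ (N⁻v⊆T , v , v∈T , v∉N⁻v v)

  outDominating-if-∣∁∣≤d⁻ : ∀ {S} → (∀ v → ∣ ∁ S ∣ ≤ d⁻ D v) → OutDominating D S
  outDominating-if-∣∁∣≤d⁻ ∣∁S∣≤d⁻ v v∉S with in-neighbour-outside (x∉p⇒x∈∁p v∉S) (∣∁S∣≤d⁻ v)
  ... | u , u∉∁S , arc = u , x∉∁p⇒x∈p u∉∁S , arc

∣p∪⁅x⁆∣≤1+∣p∣ : ∀ {n} (p : Subset n) x → ∣ p ∪ ⁅ x ⁆ ∣ ≤ suc ∣ p ∣
∣p∪⁅x⁆∣≤1+∣p∣ (outside ∷ p) Fin.zero    rewrite ∪-identityʳ p = ≤-refl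
∣p∪⁅x⁆∣≤1+∣p∣ (inside  ∷ p) Fin.zero    rewrite ∪-identityʳ p = n≤1+n _
∣p∪⁅x⁆∣≤1+∣p∣ (outside ∷ p) (Fin.suc x) = ∣p∪⁅x⁆∣≤1+∣p∣ p x
∣p∪⁅x⁆∣≤1+∣p∣ (inside  ∷ p) (Fin.suc x) = s≤s (∣p∪⁅x⁆∣≤1+∣p∣ p x)

p⊆p-x∪⁅x⁆ : ∀ {n} (p : Subset n) x → p ⊆ (p - x) ∪ ⁅ x ⁆
p⊆p-x∪⁅x⁆ p x {y} y∈p with y ≟ x
... | yes refl = q⊆p∪q (p - x) ⁅ x ⁆ (x∈⁅x⁆ x)
... | no  y≢x  = p⊆p∪q ⁅ x ⁆ (x∈p∧x≢y⇒x∈p-y y∈p y≢x)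

∣p∣≤1+∣p-x∣ : ∀ {n} (p : Subset n) x → ∣ p ∣ ≤ suc ∣ p - x ∣
∣p∣≤1+∣p-x∣ p x = ≤-trans (p⊆q⇒∣p∣≤∣q∣ (p⊆p-x∪⁅x⁆ p x)) (∣p∪⁅x⁆∣≤1+∣p∣ (p - x) x)

∣p∣≤∣p-u∪⁅x⁆∣ : ∀ {n} (p : Subset n) u {x} → x ∉ p → ∣ p ∣ ≤ ∣ (p - u) ∪ ⁅ x ⁆ ∣
∣p∣≤∣p-u∪⁅x⁆∣ p u {x} x∉p = ≤-trans (∣p∣≤1+∣p-x∣ p u) (p⊂q⇒∣p∣<∣q∣ p-u⊂p-u∪⁅x⁆)
  where
  p-u⊂p-u∪⁅x⁆ : p - u ⊂ (p - u) ∪ ⁅ x ⁆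
  p-u⊂p-u∪⁅x⁆ =
    p⊆p∪q ⁅ x ⁆ , x , q⊆p∪q (p - u) ⁅ x ⁆ (x∈⁅x⁆ x) , λ x∈p-u → x∉p (p─q⊆p p ⁅ u ⁆ x∈p-u)

∣p∣≤∣q∣⇒∣∁q∣≤∣∁p∣ : ∀ {n} (p q : Subset n) → ∣ p ∣ ≤ ∣ q ∣ → ∣ ∁ q ∣ ≤ ∣ ∁ p ∣
∣p∣≤∣q∣⇒∣∁q∣≤∣∁p∣ {n} p q ∣p∣≤∣q∣ = begin
  ∣ ∁ q ∣   ≡⟨ ∣∁p∣≡n∸∣p∣ q ⟩
  n ∸ ∣ q ∣ ≤⟨ ∸-monoʳ-≤ n ∣p∣≤∣q∣ ⟩
  n ∸ ∣ p ∣ ≡⟨ sym (∣∁p∣≡n∸∣p∣ p) ⟩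
  ∣ ∁ p ∣   ∎
  where open ≤-Reasoning

OSODS-if-∣∁∣≤d⁻ : ∀ {n} (D : Digraph n) {S} → (∀ v → ∣ ∁ S ∣ ≤ d⁻ D v) → OSODS D S
OSODS-if-∣∁∣≤d⁻ D {S} ∣∁S∣≤d⁻ = outDominating-if-∣∁∣≤d⁻ D ∣∁S∣≤d⁻ , secure
  where
  secure : ∀ v → v ∉ S → ∃[ u ] (u ∈ S × Arc D u v × OutDominating D ((S - u) ∪ ⁅ v ⁆))
  secure v v∉S with outDominating-if-∣∁∣≤d⁻ D ∣∁S∣≤d⁻ v v∉S
  ... | u , u∈S , arc =
    u , u∈S , arc , outDominating-if-∣∁∣≤d⁻ D (λ w → ≤-trans ∣∁S′∣≤∣∁S∣ (∣∁S∣≤d⁻ w))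
    where
    S′ = (S - u) ∪ ⁅ v ⁆
    ∣∁S′∣≤∣∁S∣ : ∣ ∁ S′ ∣ ≤ ∣ ∁ S ∣
    ∣∁S′∣≤∣∁S∣ = ∣p∣≤∣q∣⇒∣∁q∣≤∣∁p∣ S S′ (∣p∣≤∣p-u∪⁅x⁆∣ S u v∉S)

subset-of-size : ∀ n m → m ≤ n → Σ (Subset n) (λ p → ∣ p ∣ ≡ m)
subset-of-size n       zero    _         = ⊥ , ∣⊥∣≡0 n
subset-of-size (suc n) (suc m) (s≤s m≤n) with subset-of-size n m m≤n
... | p , ∣p∣≡m = inside ∷ p , cong suc ∣p∣≡m

m∸[m∸n]≤n : ∀ m n → m ∸ (m ∸ n) ≤ n
m∸[m∸n]≤n m n = m≤n+o⇒m∸n≤o m (m ∸ n) (≤-trans (m≤n+m∸n m n) (≤-reflexive (+-comm n (m ∸ n))))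

foldr′-⊓≤lookup : ∀ {m} b (xs : Vec ℕ m) i → foldr′ _⊓_ b xs ≤ lookup xs i
foldr′-⊓≤lookup b (x ∷ xs) Fin.zero    = m⊓n≤m x _
foldr′-⊓≤lookup b (x ∷ xs) (Fin.suc i) = ≤-trans (m⊓n≤n x _) (foldr′-⊓≤lookup b xs i)

δ⁰≤d⁻ : ∀ {n} (D : Digraph n) v → δ⁰ D ≤ d⁻ D v
δ⁰≤d⁻ {suc n} D v = begin
  δ⁰ D                                ≤⟨ foldr′-⊓≤lookup _ (vmap d⁰ (allFin (suc n))) v ⟩
  lookup (vmap d⁰ (allFin (suc n))) v ≡⟨ lookup-map v d⁰ (allFin (suc n)) ⟩
  d⁰ (lookup (allFin (suc n)) v)      ≡⟨ cong d⁰ (lookup-allFin v) ⟩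
  d⁰ v                                ≤⟨ m⊓n≤n (d⁺ D v) (d⁻ D v) ⟩
  d⁻ D v                              ∎
  where
  open ≤-Reasoning
  d⁰ : Fin (suc n) → ℕ
  d⁰ w = d⁺ D w ⊓ d⁻ D w

theorem2p4 : (n : ℕ) (D : Digraph n) →
    ∃[ S ] (OSODS D S × ∣ S ∣ ≤ n ∸ δ⁰ D)
theorem2p4 n D with subset-of-size n (n ∸ δ⁰ D) (m∸n≤m n (δ⁰ D))
... | S , ∣S∣≡n∸δ⁰ = S , OSODS-if-∣∁∣≤d⁻ D ∣∁S∣≤d⁻ , ≤-reflexive ∣S∣≡n∸δ⁰
  where
  ∣∁S∣≤δ⁰ : ∣ ∁ S ∣ ≤ δ⁰ D
  ∣∁S∣≤δ⁰ = begin
    ∣ ∁ S ∣             ≡⟨ ∣∁p∣≡n∸∣p∣ S ⟩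
    n ∸ ∣ S ∣           ≡⟨ cong (n ∸_) ∣S∣≡n∸δ⁰ ⟩
    n ∸ (n ∸ δ⁰ D)      ≤⟨ m∸[m∸n]≤n n (δ⁰ D) ⟩
    δ⁰ D                ∎
    where open ≤-Reasoning

  ∣∁S∣≤d⁻ : ∀ v → ∣ ∁ S ∣ ≤ d⁻ D v
  ∣∁S∣≤d⁻ v = ≤-trans ∣∁S∣≤δ⁰ (δ⁰≤d⁻ D v)
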